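{- Let $\to$ be the quantifier-elimination rewrite relation on formulas defined in the context. Then the reverse relation $\leftarrow$ (where $G \leftarrow F$ iff $F \to G$) is well-founded. That is, every non-empty class $B$ of formulas contains an element $a$ such that there is no $a' \in B$ with $a \to a'$. In particular, $\to$ is terminating: there is no infinite sequence $(F_i)_{i\in\mathbb N}$ with $F_i \to F_{i+1}$ for all $i$.
   Context: Terms and formulas are those of first-order logic extended by Hilbert's $\varepsilon$-binder. The syntax has: - individual variables; - $n$-ary formula variables $A$ (free second-order variables, never bound), giving atomic formulas $A(t_1,\dots,t_n)$; - $n$-ary function and predicate symbols; - the connectives $\neg,\vee,\wedge,\Rightarrow,\dots$; - for an individual variable $x$ and a formula $F$: the term $\varepsilon x.\,F$ and the formulas $\exists x.\,F$ and $\forall x.\,F$, each binding $x$. Formulas and terms are identified modulo renaming of bound variables. Substitution $F\{x\mapsto t\}$ replaces the free occurrences of $x$ by $t$ and is capture-avoiding. For $Q\in\{\exists,\forall\}$, write $\neg^{\forall}$ for $\neg$ and $\neg^{\exists}$ for the empty string. The rewrite relation $\to$ on formulas is defined as follows: $F_1\to F_2$ iff $F_2$ is obtained from $F_1$ by replacing one occurrence of a subformula $Q x.\,A$ (with $Q\in\{\exists,\forall\}$) by $A\{x\mapsto \varepsilon x.\,\neg^{Q}A\}$. The occurrence may lie anywhere, including inside $\varepsilon$-terms and under binders. -}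

module Defs where

open import Data.Nat using (ℕ; zero; suc)
open import Data.List using (List; []; _∷_)

-- Syntax of first-order logic with Hilbert's ε-binder, in de Bruijn style
-- (so formulas/terms are identified modulo renaming of bound variables
-- by construction).  Individual variables are de Bruijn indices; an index
-- pointing past all enclosing binders denotes a free individual variable.
-- Function, predicate and formula-variable symbols are named by ℕ; the
-- arity of an application is the length of its argument list.

data Formula : Set
data Term : Set

data Term where
  var : ℕ → Term
  fun : ℕ → List Term → Term
  eps : Formula → Term                -- ε x. F   (binds index 0 in F)

data Formula where
  fvar  : ℕ → List Term → Formula
  pred  : ℕ → List Term → Formula
  top   : Formula
  bot   : Formula
  neg   : Formula → Formula
  conj  : Formula → Formula → Formula
  disj  : Formula → Formula → Formula
  impl  : Formula → Formula → Formula
  equiv : Formula → Formula → Formula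
  ex    : Formula → Formula           -- ∃ x. F   (binds index 0 in F)
  all   : Formula → Formula           -- ∀ x. F   (binds index 0 in F)

lift : (ℕ → ℕ) → ℕ → ℕ
lift ρ zero    = zero
lift ρ (suc n) = suc (ρ n)

renT  : (ℕ → ℕ) → Term → Term
renTs : (ℕ → ℕ) → List Term → List Term
renF  : (ℕ → ℕ) → Formula → Formula

renT ρ (var n)    = var (ρ n)
renT ρ (fun f ts) = fun f (renTs ρ ts)
renT ρ (eps F)    = eps (renF (lift ρ) F)

renTs ρ []       = []
renTs ρ (t ∷ ts) = renT ρ t ∷ renTs ρ ts

renF ρ (fvar a ts)  = fvar a (renTs ρ ts)
renF ρ (pred p ts)  = pred p (renTs ρ ts)
renF ρ top          = top
renF ρ bot          = bot
renF ρ (neg F)      = neg (renF ρ F)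
renF ρ (conj F G)   = conj (renF ρ F) (renF ρ G)
renF ρ (disj F G)   = disj (renF ρ F) (renF ρ G)
renF ρ (impl F G)   = impl (renF ρ F) (renF ρ G)
renF ρ (equiv F G)  = equiv (renF ρ F) (renF ρ G)
renF ρ (ex F)       = ex (renF (lift ρ) F)
renF ρ (all F)      = all (renF (lift ρ) F)

exts : (ℕ → Term) → ℕ → Term
exts σ zero    = var zero
exts σ (suc n) = renT suc (σ n)

subT  : (ℕ → Term) → Term → Term
subTs : (ℕ → Term) → List Term → List Term
subF  : (ℕ → Term) → Formula → Formula

subT σ (var n)    = σ n
subT σ (fun f ts) = fun f (subTs σ ts)
subT σ (eps F)    = eps (subF (exts σ) F)

subTs σ []       = []
subTs σ (t ∷ ts) = subT σ t ∷ subTs σ ts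

subF σ (fvar a ts)  = fvar a (subTs σ ts)
subF σ (pred p ts)  = pred p (subTs σ ts)
subF σ top          = top
subF σ bot          = bot
subF σ (neg F)      = neg (subF σ F)
subF σ (conj F G)   = conj (subF σ F) (subF σ G)
subF σ (disj F G)   = disj (subF σ F) (subF σ G)
subF σ (impl F G)   = impl (subF σ F) (subF σ G)
subF σ (equiv F G)  = equiv (subF σ F) (subF σ G)
subF σ (ex F)       = ex (subF (exts σ) F)
subF σ (all F)      = all (subF (exts σ) F)

-- Single substitution: for a body A of a binder Q x. A, A [ t ] is
-- A{x ↦ t} (index 0 replaced by t, other indices shifted down).
single : Term → ℕ → Term
single t zero    = t
single t (suc n) = var n

_[_] : Formula → Term → Formula
A [ t ] = subF (single t) A

data _⟶F_ : Formula → Formula → Set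
data _⟶T_ : Term → Term → Set
data _⟶Ts_ : List Term → List Term → Set

data _⟶F_ where
  ex-step  : ∀ {A} → ex A ⟶F (A [ eps A ])
  all-step : ∀ {A} → all A ⟶F (A [ eps (neg A) ])
  fvar-c   : ∀ {a ts ts'} → ts ⟶Ts ts' → fvar a ts ⟶F fvar a ts'
  pred-c   : ∀ {p ts ts'} → ts ⟶Ts ts' → pred p ts ⟶F pred p ts'
  neg-c    : ∀ {F F'} → F ⟶F F' → neg F ⟶F neg F'
  conj-l   : ∀ {F F' G} → F ⟶F F' → conj F G ⟶F conj F' G
  conj-r   : ∀ {F G G'} → G ⟶F G' → conj F G ⟶F conj F G'
  disj-l   : ∀ {F F' G} → F ⟶F F' → disj F G ⟶F disj F' G
  disj-r   : ∀ {F G G'} → G ⟶F G' → disj F G ⟶F disj F G'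
  impl-l   : ∀ {F F' G} → F ⟶F F' → impl F G ⟶F impl F' G
  impl-r   : ∀ {F G G'} → G ⟶F G' → impl F G ⟶F impl F G'
  equiv-l  : ∀ {F F' G} → F ⟶F F' → equiv F G ⟶F equiv F' G
  equiv-r  : ∀ {F G G'} → G ⟶F G' → equiv F G ⟶F equiv F G'
  ex-c     : ∀ {F F'} → F ⟶F F' → ex F ⟶F ex F'
  all-c    : ∀ {F F'} → F ⟶F F' → all F ⟶F all F'

data _⟶T_ where
  fun-c : ∀ {f ts ts'} → ts ⟶Ts ts' → fun f ts ⟶T fun f ts'
  eps-c : ∀ {F F'} → F ⟶F F' → eps F ⟶T eps F'

data _⟶Ts_ where
  here  : ∀ {t t' ts} → t ⟶T t' → (t ∷ ts) ⟶Ts (t' ∷ ts)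
  there : ∀ {t ts ts'} → ts ⟶Ts ts' → (t ∷ ts) ⟶Ts (t ∷ ts')

_⟵_ : Formula → Formula → Set
G ⟵ F = F ⟶F G

module Submission where

-- Interpret terms and formulas as natural numbers under a valuation of the
-- individual variables: ε x. A is worth one more than A with x valued 0, and
-- ∃ x. A, ∀ x. A are worth one more than A with x valued as the witness
-- ε x. A (negation is free, so ε x. ¬A has the same value).  The value is
-- monotone in the valuation and commutes with substitution, so a root step
-- lowers it by one; a step inside the body of a quantifier lowers the body
-- and, by monotonicity, also the value assigned to the bound variable.
-- Hence every step strictly decreases the value at every valuation.

open import Defs
open import Data.Nat using (ℕ; zero; suc; _+_; _≤_; _<_; s≤s; z≤n)
open import Data.Nat.Induction using (<-wellFounded)
open import Data.Nat.Properties
  using (≤-refl; ≤-reflexive; ≤-<-trans; <⇒≤; +-mono-≤; +-monoˡ-<; +-monoʳ-<)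
open import Data.List using (List; []; _∷_)
open import Data.Product using (_×_; ∃; _,_)
open import Data.Empty using (⊥)
open import Function using (_∘_)
open import Relation.Nullary using (¬_)
open import Relation.Binary.Core using (Rel)
open import Relation.Binary.PropositionalEquality using (_≡_; _≗_; refl; trans; cong; cong₂)
open import Induction.WellFounded using (WellFounded; Acc; acc; module Subrelation)
import Relation.Binary.Construct.On as On

wellFounded⇒noDescendingChain : ∀ {a ℓ} {A : Set a} {_≺_ : Rel A ℓ} →
  WellFounded _≺_ → ¬ (∃ λ (f : ℕ → A) → ∀ i → f (suc i) ≺ f i)
wellFounded⇒noDescendingChain {_≺_ = _≺_} wf (f , descends) = noChainFrom 0 (wf (f 0))
  where
  noChainFrom : ∀ i → Acc _≺_ (f i) → ⊥
  noChainFrom i (acc rs) = noChainFrom (suc i) (rs (descends i))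

Valuation : Set
Valuation = ℕ → ℕ

_∷ᵥ_ : ℕ → Valuation → Valuation
(v ∷ᵥ ρ) zero    = v
(v ∷ᵥ ρ) (suc n) = ρ n

⟦_⟧T  : Term → Valuation → ℕ
⟦_⟧Ts : List Term → Valuation → ℕ
⟦_⟧F  : Formula → Valuation → ℕ
⟦_⟧Q  : Formula → Valuation → ℕ

⟦ var n ⟧T    ρ = ρ n
⟦ fun f ts ⟧T ρ = suc (⟦ ts ⟧Ts ρ)
⟦ eps A ⟧T    ρ = suc (⟦ A ⟧F (0 ∷ᵥ ρ))

⟦ [] ⟧Ts     ρ = 0
⟦ t ∷ ts ⟧Ts ρ = ⟦ t ⟧T ρ + ⟦ ts ⟧Ts ρ

⟦ fvar a ts ⟧F ρ = ⟦ ts ⟧Ts ρ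
⟦ pred p ts ⟧F ρ = ⟦ ts ⟧Ts ρ
⟦ top ⟧F       ρ = 0
⟦ bot ⟧F       ρ = 0
⟦ neg F ⟧F     ρ = ⟦ F ⟧F ρ
⟦ conj F G ⟧F  ρ = ⟦ F ⟧F ρ + ⟦ G ⟧F ρ
⟦ disj F G ⟧F  ρ = ⟦ F ⟧F ρ + ⟦ G ⟧F ρ
⟦ impl F G ⟧F  ρ = ⟦ F ⟧F ρ + ⟦ G ⟧F ρ
⟦ equiv F G ⟧F ρ = ⟦ F ⟧F ρ + ⟦ G ⟧F ρ
⟦ ex A ⟧F      ρ = suc (⟦ A ⟧Q ρ)
⟦ all A ⟧F     ρ = suc (⟦ A ⟧Q ρ)

-- Definitionally ⟦ A ⟧F (⟦ eps A ⟧T ρ ∷ᵥ ρ), written out to keep the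
-- recursion structural.
⟦ A ⟧Q ρ = ⟦ A ⟧F (suc (⟦ A ⟧F (0 ∷ᵥ ρ)) ∷ᵥ ρ)

_≤ᵥ_ : Valuation → Valuation → Set
ρ ≤ᵥ ρ' = ∀ n → ρ n ≤ ρ' n

∷ᵥ-mono-≤ : ∀ {v v' ρ ρ'} → v ≤ v' → ρ ≤ᵥ ρ' → (v ∷ᵥ ρ) ≤ᵥ (v' ∷ᵥ ρ')
∷ᵥ-mono-≤ v≤v' ρ≤ρ' zero    = v≤v'
∷ᵥ-mono-≤ v≤v' ρ≤ρ' (suc n) = ρ≤ρ' n

⟦⟧T-mono  : ∀ t {ρ ρ'} → ρ ≤ᵥ ρ' → ⟦ t ⟧T ρ ≤ ⟦ t ⟧T ρ'
⟦⟧Ts-mono : ∀ ts {ρ ρ'} → ρ ≤ᵥ ρ' → ⟦ ts ⟧Ts ρ ≤ ⟦ ts ⟧Ts ρ'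
⟦⟧F-mono  : ∀ F {ρ ρ'} → ρ ≤ᵥ ρ' → ⟦ F ⟧F ρ ≤ ⟦ F ⟧F ρ'
⟦⟧Q-mono  : ∀ A {ρ ρ'} → ρ ≤ᵥ ρ' → ⟦ A ⟧Q ρ ≤ ⟦ A ⟧Q ρ'

⟦⟧T-mono (var n)    ρ≤ρ' = ρ≤ρ' n
⟦⟧T-mono (fun f ts) ρ≤ρ' = s≤s (⟦⟧Ts-mono ts ρ≤ρ')
⟦⟧T-mono (eps A)    ρ≤ρ' = s≤s (⟦⟧F-mono A (∷ᵥ-mono-≤ z≤n ρ≤ρ'))

⟦⟧Ts-mono []       ρ≤ρ' = z≤n
⟦⟧Ts-mono (t ∷ ts) ρ≤ρ' = +-mono-≤ (⟦⟧T-mono t ρ≤ρ') (⟦⟧Ts-mono ts ρ≤ρ')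

⟦⟧F-mono (fvar a ts) ρ≤ρ' = ⟦⟧Ts-mono ts ρ≤ρ'
⟦⟧F-mono (pred p ts) ρ≤ρ' = ⟦⟧Ts-mono ts ρ≤ρ'
⟦⟧F-mono top         ρ≤ρ' = z≤n
⟦⟧F-mono bot         ρ≤ρ' = z≤n
⟦⟧F-mono (neg F)     ρ≤ρ' = ⟦⟧F-mono F ρ≤ρ'
⟦⟧F-mono (conj F G)  ρ≤ρ' = +-mono-≤ (⟦⟧F-mono F ρ≤ρ') (⟦⟧F-mono G ρ≤ρ')
⟦⟧F-mono (disj F G)  ρ≤ρ' = +-mono-≤ (⟦⟧F-mono F ρ≤ρ') (⟦⟧F-mono G ρ≤ρ')
⟦⟧F-mono (impl F G)  ρ≤ρ' = +-mono-≤ (⟦⟧F-mono F ρ≤ρ') (⟦⟧F-mono G ρ≤ρ')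
⟦⟧F-mono (equiv F G) ρ≤ρ' = +-mono-≤ (⟦⟧F-mono F ρ≤ρ') (⟦⟧F-mono G ρ≤ρ')
⟦⟧F-mono (ex A)      ρ≤ρ' = s≤s (⟦⟧Q-mono A ρ≤ρ')
⟦⟧F-mono (all A)     ρ≤ρ' = s≤s (⟦⟧Q-mono A ρ≤ρ')

⟦⟧Q-mono A ρ≤ρ' = ⟦⟧F-mono A (∷ᵥ-mono-≤ (s≤s (⟦⟧F-mono A (∷ᵥ-mono-≤ z≤n ρ≤ρ'))) ρ≤ρ')

∷ᵥ-lift : ∀ {v v' ρ ρ' r} → v ≡ v' → ρ ∘ r ≗ ρ' → (v ∷ᵥ ρ) ∘ lift r ≗ (v' ∷ᵥ ρ')
∷ᵥ-lift v≡v' ρr≗ρ' zero    = v≡v'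
∷ᵥ-lift v≡v' ρr≗ρ' (suc n) = ρr≗ρ' n

⟦renT⟧  : ∀ t r {ρ ρ'} → ρ ∘ r ≗ ρ' → ⟦ renT r t ⟧T ρ ≡ ⟦ t ⟧T ρ'
⟦renTs⟧ : ∀ ts r {ρ ρ'} → ρ ∘ r ≗ ρ' → ⟦ renTs r ts ⟧Ts ρ ≡ ⟦ ts ⟧Ts ρ'
⟦renF⟧  : ∀ F r {ρ ρ'} → ρ ∘ r ≗ ρ' → ⟦ renF r F ⟧F ρ ≡ ⟦ F ⟧F ρ'
⟦renQ⟧  : ∀ A r {ρ ρ'} → ρ ∘ r ≗ ρ' → ⟦ renF (lift r) A ⟧Q ρ ≡ ⟦ A ⟧Q ρ'

⟦renT⟧ (var n)    r h = h n
⟦renT⟧ (fun f ts) r h = cong suc (⟦renTs⟧ ts r h)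
⟦renT⟧ (eps A)    r h = cong suc (⟦renF⟧ A (lift r) (∷ᵥ-lift refl h))

⟦renTs⟧ []       r h = refl
⟦renTs⟧ (t ∷ ts) r h = cong₂ _+_ (⟦renT⟧ t r h) (⟦renTs⟧ ts r h)

⟦renF⟧ (fvar a ts) r h = ⟦renTs⟧ ts r h
⟦renF⟧ (pred p ts) r h = ⟦renTs⟧ ts r h
⟦renF⟧ top         r h = refl
⟦renF⟧ bot         r h = refl
⟦renF⟧ (neg F)     r h = ⟦renF⟧ F r h
⟦renF⟧ (conj F G)  r h = cong₂ _+_ (⟦renF⟧ F r h) (⟦renF⟧ G r h)
⟦renF⟧ (disj F G)  r h = cong₂ _+_ (⟦renF⟧ F r h) (⟦renF⟧ G r h)
⟦renF⟧ (impl F G)  r h = cong₂ _+_ (⟦renF⟧ F r h) (⟦renF⟧ G r h)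
⟦renF⟧ (equiv F G) r h = cong₂ _+_ (⟦renF⟧ F r h) (⟦renF⟧ G r h)
⟦renF⟧ (ex A)      r h = cong suc (⟦renQ⟧ A r h)
⟦renF⟧ (all A)     r h = cong suc (⟦renQ⟧ A r h)

⟦renQ⟧ A r h =
  ⟦renF⟧ A (lift r) (∷ᵥ-lift (cong suc (⟦renF⟧ A (lift r) (∷ᵥ-lift refl h))) h)

∷ᵥ-exts : ∀ {v v' ρ ρ' σ} → v ≡ v' → (λ n → ⟦ σ n ⟧T ρ) ≗ ρ' →
  (λ n → ⟦ exts σ n ⟧T (v ∷ᵥ ρ)) ≗ (v' ∷ᵥ ρ')
∷ᵥ-exts         v≡v' σρ≗ρ' zero    = v≡v'
∷ᵥ-exts {σ = σ} v≡v' σρ≗ρ' (suc n) = trans (⟦renT⟧ (σ n) suc λ _ → refl) (σρ≗ρ' n)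

⟦subT⟧  : ∀ t σ {ρ ρ'} → (λ n → ⟦ σ n ⟧T ρ) ≗ ρ' → ⟦ subT σ t ⟧T ρ ≡ ⟦ t ⟧T ρ'
⟦subTs⟧ : ∀ ts σ {ρ ρ'} → (λ n → ⟦ σ n ⟧T ρ) ≗ ρ' → ⟦ subTs σ ts ⟧Ts ρ ≡ ⟦ ts ⟧Ts ρ'
⟦subF⟧  : ∀ F σ {ρ ρ'} → (λ n → ⟦ σ n ⟧T ρ) ≗ ρ' → ⟦ subF σ F ⟧F ρ ≡ ⟦ F ⟧F ρ'
⟦subQ⟧  : ∀ A σ {ρ ρ'} → (λ n → ⟦ σ n ⟧T ρ) ≗ ρ' → ⟦ subF (exts σ) A ⟧Q ρ ≡ ⟦ A ⟧Q ρ'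

⟦subT⟧ (var n)    σ h = h n
⟦subT⟧ (fun f ts) σ h = cong suc (⟦subTs⟧ ts σ h)
⟦subT⟧ (eps A)    σ h = cong suc (⟦subF⟧ A (exts σ) (∷ᵥ-exts refl h))

⟦subTs⟧ []       σ h = refl
⟦subTs⟧ (t ∷ ts) σ h = cong₂ _+_ (⟦subT⟧ t σ h) (⟦subTs⟧ ts σ h)

⟦subF⟧ (fvar a ts) σ h = ⟦subTs⟧ ts σ h
⟦subF⟧ (pred p ts) σ h = ⟦subTs⟧ ts σ h
⟦subF⟧ top         σ h = refl
⟦subF⟧ bot         σ h = refl
⟦subF⟧ (neg F)     σ h = ⟦subF⟧ F σ h
⟦subF⟧ (conj F G)  σ h = cong₂ _+_ (⟦subF⟧ F σ h) (⟦subF⟧ G σ h)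
⟦subF⟧ (disj F G)  σ h = cong₂ _+_ (⟦subF⟧ F σ h) (⟦subF⟧ G σ h)
⟦subF⟧ (impl F G)  σ h = cong₂ _+_ (⟦subF⟧ F σ h) (⟦subF⟧ G σ h)
⟦subF⟧ (equiv F G) σ h = cong₂ _+_ (⟦subF⟧ F σ h) (⟦subF⟧ G σ h)
⟦subF⟧ (ex A)      σ h = cong suc (⟦subQ⟧ A σ h)
⟦subF⟧ (all A)     σ h = cong suc (⟦subQ⟧ A σ h)

⟦subQ⟧ A σ h =
  ⟦subF⟧ A (exts σ) (∷ᵥ-exts (cong suc (⟦subF⟧ A (exts σ) (∷ᵥ-exts refl h))) h)

⟦[]⟧ : ∀ A t ρ → ⟦ A [ t ] ⟧F ρ ≡ ⟦ A ⟧F (⟦ t ⟧T ρ ∷ᵥ ρ)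
⟦[]⟧ A t ρ = ⟦subF⟧ A (single t) λ { zero → refl ; (suc n) → refl }

⟶F-decreasing  : ∀ {F F'} → F ⟶F F' → ∀ ρ → ⟦ F' ⟧F ρ < ⟦ F ⟧F ρ
⟶T-decreasing  : ∀ {t t'} → t ⟶T t' → ∀ ρ → ⟦ t' ⟧T ρ < ⟦ t ⟧T ρ
⟶Ts-decreasing : ∀ {ts ts'} → ts ⟶Ts ts' → ∀ ρ → ⟦ ts' ⟧Ts ρ < ⟦ ts ⟧Ts ρ
⟶Q-decreasing  : ∀ {A A'} → A ⟶F A' → ∀ ρ → ⟦ A' ⟧Q ρ < ⟦ A ⟧Q ρ

⟶F-decreasing (ex-step {A})       ρ = s≤s (≤-reflexive (⟦[]⟧ A (eps A) ρ))
⟶F-decreasing (all-step {A})      ρ = s≤s (≤-reflexive (⟦[]⟧ A (eps (neg A)) ρ))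
⟶F-decreasing (fvar-c s)          ρ = ⟶Ts-decreasing s ρ
⟶F-decreasing (pred-c s)          ρ = ⟶Ts-decreasing s ρ
⟶F-decreasing (neg-c s)           ρ = ⟶F-decreasing s ρ
⟶F-decreasing (conj-l {G = G} s)  ρ = +-monoˡ-< (⟦ G ⟧F ρ) (⟶F-decreasing s ρ)
⟶F-decreasing (conj-r {F = F} s)  ρ = +-monoʳ-< (⟦ F ⟧F ρ) (⟶F-decreasing s ρ)
⟶F-decreasing (disj-l {G = G} s)  ρ = +-monoˡ-< (⟦ G ⟧F ρ) (⟶F-decreasing s ρ)
⟶F-decreasing (disj-r {F = F} s)  ρ = +-monoʳ-< (⟦ F ⟧F ρ) (⟶F-decreasing s ρ)
⟶F-decreasing (impl-l {G = G} s)  ρ = +-monoˡ-< (⟦ G ⟧F ρ) (⟶F-decreasing s ρ)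
⟶F-decreasing (impl-r {F = F} s)  ρ = +-monoʳ-< (⟦ F ⟧F ρ) (⟶F-decreasing s ρ)
⟶F-decreasing (equiv-l {G = G} s) ρ = +-monoˡ-< (⟦ G ⟧F ρ) (⟶F-decreasing s ρ)
⟶F-decreasing (equiv-r {F = F} s) ρ = +-monoʳ-< (⟦ F ⟧F ρ) (⟶F-decreasing s ρ)
⟶F-decreasing (ex-c s)            ρ = s≤s (⟶Q-decreasing s ρ)
⟶F-decreasing (all-c s)           ρ = s≤s (⟶Q-decreasing s ρ)

⟶T-decreasing (fun-c s) ρ = s≤s (⟶Ts-decreasing s ρ)
⟶T-decreasing (eps-c s) ρ = s≤s (⟶F-decreasing s (0 ∷ᵥ ρ))

⟶Ts-decreasing (here {ts = ts} s) ρ = +-monoˡ-< (⟦ ts ⟧Ts ρ) (⟶T-decreasing s ρ)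
⟶Ts-decreasing (there {t = t} s)  ρ = +-monoʳ-< (⟦ t ⟧T ρ) (⟶Ts-decreasing s ρ)

⟶Q-decreasing {A} {A'} s ρ =
  ≤-<-trans (⟦⟧F-mono A' (∷ᵥ-mono-≤ witness≤ λ _ → ≤-refl)) (⟶F-decreasing s _)
  where
  witness≤ : ⟦ eps A' ⟧T ρ ≤ ⟦ eps A ⟧T ρ
  witness≤ = s≤s (<⇒≤ (⟶F-decreasing s (0 ∷ᵥ ρ)))

measure : Formula → ℕ
measure F = ⟦ F ⟧F (λ _ → 0)

⟵-wellFounded : WellFounded _⟵_
⟵-wellFounded = Subrelation.wellFounded (λ step → ⟶F-decreasing step _)
                                         (On.wellFounded measure <-wellFounded)

theorem3p7 : WellFounded _⟵_
    × ¬ (∃ λ (F : ℕ → Formula) → ∀ i → F i ⟶F F (suc i))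
theorem3p7 = ⟵-wellFounded , wellFounded⇒noDescendingChain ⟵-wellFounded
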